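{- Let $m\ge 1$ and let $G=(U\cup V,E)$ be a bipartite graph with $m$ edges. Then $h(G)\le m\log m$. Equality holds if and only if $G$, after deleting its isolated vertices, is a complete bipartite graph.
   Context: For $x\ge 0$ let $f(x)=x\log x$ (natural logarithm), with $f(0)=0$. For a graph $G$ with degree sequence $(d_v)_{v\in V(G)}$, $h(G)=\sum_{v} f(d_v)$. (The first-degree based entropy of $G$ is $I(G)=\log(2m)-\frac{1}{2m}h(G)$, so maximizing $h$ is minimizing the entropy.) -}

module Defs where

open import Data.Nat using (ℕ; zero; suc; _+_; _*_; _^_; _≤_; _<_)
open import Data.Fin using (Fin; zero; suc)
open import Data.Bool using (Bool; true; false; T; if_then_else_)
open import Data.Product using (_×_)
open import Function.Bundles using (_⇔_)

Σ[<_] : (n : ℕ) → (Fin n → ℕ) → ℕ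
Σ[< zero ] f = 0
Σ[< suc n ] f = f zero + Σ[< n ] (λ i → f (suc i))

Π[<_] : (n : ℕ) → (Fin n → ℕ) → ℕ
Π[< zero ] f = 1
Π[< suc n ] f = f zero * Π[< n ] (λ i → f (suc i))

record BipGraph (p q : ℕ) : Set where
  field
    adj : Fin p → Fin q → Bool

open BipGraph public

module _ {p q : ℕ} (G : BipGraph p q) where

  degU : Fin p → ℕ
  degU u = Σ[< q ] (λ v → if adj G u v then 1 else 0)

  degV : Fin q → ℕ
  degV v = Σ[< p ] (λ u → if adj G u v then 1 else 0)

  edges : ℕ
  edges = Σ[< p ] degU

  -- exp(h(G)) = ∏_v d_v^{d_v}  (with 0^0 = 1, matching f(0) = 0).
  -- Since exp is strictly increasing, h(G) ≤ m log m ⇔ expH ≤ m^m,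
  -- and h(G) = m log m ⇔ expH = m^m.
  expH : ℕ
  expH = Π[< p ] (λ u → degU u ^ degU u) * Π[< q ] (λ v → degV v ^ degV v)

  CompleteBipartiteModIsolated : Set
  CompleteBipartiteModIsolated =
    ∀ (u : Fin p) (v : Fin q) → 0 < degU u → 0 < degV v → T (adj G u v)

-- Give each edge uv the weight d(u)·d(v). The product of the m weights is ∏_w d(w)^d(w) = exp h(G), since every
-- vertex w contributes the factor d(w) once for each of its d(w) edges, and their sum is at most
-- Σ_{u∈U} Σ_{v∈V} d(u)·d(v) = m², strictly less if some non-isolated u and v are not adjacent. The AM-GM
-- inequality over ℕ, proved by smoothing, turns this into exp h(G) ≤ m^m, strictly in the latter case; conversely,
-- if the non-isolated vertices span a complete bipartite graph K_{a,b}, every weight equals b·a = m.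
module Submission where

open import Data.Bool using (Bool; true; false; T; if_then_else_)
open import Data.Empty using (⊥-elim)
open import Data.Fin using (Fin; zero; suc)
open import Data.List using (List; []; _∷_; [_]; _++_; length; concat; tabulate)
open import Data.List.Properties using (length-++)
open import Data.List.Membership.Propositional using (find)
open import Data.List.Membership.Propositional.Properties using (∈-∃++)
open import Data.List.Relation.Binary.Permutation.Propositional using (_↭_; prep; ↭-trans)
open import Data.List.Relation.Binary.Permutation.Propositional.Properties using (↭-length; shift)
open import Data.List.Relation.Unary.All using (All; []; _∷_; all?)
open import Data.List.Relation.Unary.All.Properties using (¬All⇒Any¬; concat⁺; tabulate⁺)
open import Data.List.Relation.Unary.Any as Any using (Any; here; there)
open import Data.Nat
open import Data.Nat.ListAction using (sum; product)
open import Data.Nat.ListAction.Properties using (sum-++; product-++; sum-↭; product-↭)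
open import Data.Nat.Properties
open import Data.Nat.Tactic.RingSolver using (solve-∀)
open import Data.Product using (∃; ∃₂; _×_; _,_)
open import Defs
open import Function using (_∘_; flip)
open import Function.Bundles using (_⇔_; mk⇔)
open import Relation.Binary.PropositionalEquality
  using (_≡_; refl; sym; trans; cong; cong₂; subst; module ≡-Reasoning)
open import Relation.Nullary using (¬_; yes; no)
open import Relation.Nullary.Decidable using (T?; decidable-stable)

import Algebra.Properties.Semiring.Sum +-*-semiring as Sum
import Algebra.Properties.CommutativeMonoid.Sum *-1-commutativeMonoid as Prod

Any⇒↭∷ : ∀ {A : Set} {P : A → Set} {xs} → Any P xs → ∃₂ λ x rs → P x × xs ↭ x ∷ rs
Any⇒↭∷ any with x , x∈xs , px ← find any with ys , zs , refl ← ∈-∃++ x∈xs =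
  x , ys ++ zs , px , shift x ys zs

All≤⇒sum≤* : ∀ {M xs} → All (_≤ M) xs → sum xs ≤ length xs * M
All≤⇒sum≤* []            = z≤n
All≤⇒sum≤* (x≤M ∷ xs≤M) = +-mono-≤ x≤M (All≤⇒sum≤* xs≤M)

sum<*⇒Any< : ∀ {M} xs → sum xs < length xs * M → Any (_< M) xs
sum<*⇒Any< {M} (x ∷ xs) s with x <? M
... | yes x<M = here x<M
... | no  x≮M = there (sum<*⇒Any< xs (+-cancelˡ-< M _ _ (≤-<-trans (+-monoˡ-≤ (sum xs) (≮⇒≥ x≮M)) s)))

sum-tail< : ∀ {M y rs} xs → xs ↭ y ∷ rs → M < y → sum xs ≤ suc (length rs) * M →
  sum rs < length rs * M
sum-tail< {M} {y} {rs} xs xs↭y∷rs M<y s = +-cancelˡ-< M _ _ (begin-strict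
  M + sum rs        <⟨ +-monoˡ-< (sum rs) M<y ⟩
  y + sum rs        ≡⟨ sum-↭ xs↭y∷rs ⟨
  sum xs            ≤⟨ s ⟩
  M + length rs * M ∎)
  where open ≤-Reasoning

balance : ∀ {x M} e → x ≤ M → (M + e) * x ≤ M * (x + e)
balance {x} {M} e x≤M = begin
  (M + e) * x   ≡⟨ *-distribʳ-+ x M e ⟩
  M * x + e * x ≤⟨ +-monoʳ-≤ (M * x) (*-monoʳ-≤ e x≤M) ⟩
  M * x + e * M ≡⟨ cong (M * x +_) (*-comm e M) ⟩
  M * x + M * e ≡⟨ *-distribˡ-+ M x e ⟨
  M * (x + e)   ∎
  where open ≤-Reasoning

-- Smoothing: unless all entries are at most M, some y = M + e and some x < M are replaced by M and x + e,
-- which lowers the sum by exactly M and does not decrease the product.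
extract-mean : ∀ {M} k xs → length xs ≡ suc k → sum xs ≤ suc k * M →
  ∃ λ ys → length ys ≡ k × sum ys ≤ k * M × product xs ≤ M * product ys
extract-mean {M} k xs len s with all? (_≤? M) xs
extract-mean {M} k (x ∷ xs) refl s | yes (x≤M ∷ xs≤M) =
  xs , refl , All≤⇒sum≤* xs≤M , *-monoˡ-≤ (product xs) x≤M
... | no xs≰M
  with y , rs , M<y , xs↭y∷rs ← Any⇒↭∷ (Any.map ≰⇒> (¬All⇒Any¬ (_≤? M) xs xs≰M))
  with refl ← suc-injective (trans (sym (↭-length xs↭y∷rs)) len)
  with x , ts , x<M , rs↭x∷ts ← Any⇒↭∷ (sum<*⇒Any< rs (sum-tail< xs xs↭y∷rs M<y s))
  with e , refl ← m≤n⇒∃[o]m+o≡n (<⇒≤ M<y)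
  = (x + e) ∷ ts , sym (↭-length rs↭x∷ts) , +-cancelˡ-≤ M _ _ sum-bound , product-bound
  where
  σ : xs ↭ M + e ∷ x ∷ ts
  σ = ↭-trans xs↭y∷rs (prep _ rs↭x∷ts)
  sum-bound : M + (x + e + sum ts) ≤ M + length rs * M
  sum-bound = begin
    M + (x + e + sum ts) ≡⟨ rearrange M e x (sum ts) ⟩
    M + e + (x + sum ts) ≡⟨ sum-↭ σ ⟨
    sum xs               ≤⟨ s ⟩
    M + length rs * M    ∎
    where
    open ≤-Reasoning
    rearrange : ∀ M e x t → M + (x + e + t) ≡ M + e + (x + t)
    rearrange = solve-∀
  product-bound : product xs ≤ M * ((x + e) * product ts)
  product-bound = begin
    product xs                 ≡⟨ product-↭ σ ⟩
    (M + e) * (x * product ts) ≡⟨ *-assoc (M + e) x _ ⟨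
    (M + e) * x * product ts   ≤⟨ *-monoˡ-≤ (product ts) (balance e (<⇒≤ x<M)) ⟩
    M * (x + e) * product ts   ≡⟨ *-assoc M (x + e) _ ⟩
    M * ((x + e) * product ts) ∎
    where open ≤-Reasoning

sum≤*⇒product≤^ : ∀ {M} k xs → length xs ≡ k → sum xs ≤ k * M → product xs ≤ M ^ k
sum≤*⇒product≤^ zero [] refl _ = ≤-refl
sum≤*⇒product≤^ {M} (suc k) xs len s with ys , |ys| , s′ , p ← extract-mean k xs len s =
  ≤-trans p (*-monoʳ-≤ M (sum≤*⇒product≤^ k ys |ys| s′))

-- Raising one entry by 1 keeps the mean at most M and strictly increases a nonzero product.
sum<*⇒product<^ : ∀ {M} k xs → 0 < M → length xs ≡ k → sum xs < k * M → product xs < M ^ k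
sum<*⇒product<^ _ [] _ refl ()
sum<*⇒product<^ {M} k (x ∷ xs) 0<M refl s
  with product xs | sum≤*⇒product≤^ k (suc x ∷ xs) refl s
... | zero  | _ rewrite *-zeroʳ x = m^n>0 M {{>-nonZero 0<M}} k
... | suc P | suc-x*P≤M^k = <-≤-trans (*-monoˡ-< (suc P) (n<1+n x)) suc-x*P≤M^k

All≡⇒product≡^ : ∀ {m xs} → All (_≡ m) xs → product xs ≡ m ^ length xs
All≡⇒product≡^ []                 = refl
All≡⇒product≡^ {m} (refl ∷ xs≡m) = cong (m *_) (All≡⇒product≡^ xs≡m)

Σ≡sum : ∀ n (f : Fin n → ℕ) → Σ[< n ] f ≡ Sum.sum f
Σ≡sum zero    f = refl
Σ≡sum (suc n) f = cong (f zero +_) (Σ≡sum n (f ∘ suc))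

Π≡product : ∀ n (f : Fin n → ℕ) → Π[< n ] f ≡ Prod.sum f
Π≡product zero    f = refl
Π≡product (suc n) f = cong (f zero *_) (Π≡product n (f ∘ suc))

Σ-cong : ∀ n {f g : Fin n → ℕ} → (∀ i → f i ≡ g i) → Σ[< n ] f ≡ Σ[< n ] g
Σ-cong zero    f≗g = refl
Σ-cong (suc n) f≗g = cong₂ _+_ (f≗g zero) (Σ-cong n (f≗g ∘ suc))

Π-cong : ∀ n {f g : Fin n → ℕ} → (∀ i → f i ≡ g i) → Π[< n ] f ≡ Π[< n ] g
Π-cong zero    f≗g = refl
Π-cong (suc n) f≗g = cong₂ _*_ (f≗g zero) (Π-cong n (f≗g ∘ suc))

Σ-mono : ∀ n {f g : Fin n → ℕ} → (∀ i → f i ≤ g i) → Σ[< n ] f ≤ Σ[< n ] g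
Σ-mono zero    f≤g = ≤-refl
Σ-mono (suc n) f≤g = +-mono-≤ (f≤g zero) (Σ-mono n (f≤g ∘ suc))

Σ-mono-< : ∀ n {f g : Fin n → ℕ} → (∀ i → f i ≤ g i) → ∀ j → f j < g j → Σ[< n ] f < Σ[< n ] g
Σ-mono-< (suc n) f≤g zero    fj<gj = +-mono-<-≤ fj<gj (Σ-mono n (f≤g ∘ suc))
Σ-mono-< (suc n) f≤g (suc j) fj<gj = +-mono-≤-< (f≤g zero) (Σ-mono-< n (f≤g ∘ suc) j fj<gj)

Σ-comm : ∀ m n (f : Fin m → Fin n → ℕ) →
  Σ[< m ] (λ i → Σ[< n ] (f i)) ≡ Σ[< n ] (λ j → Σ[< m ] (λ i → f i j))
Σ-comm m n f = begin
  Σ[< m ] (λ i → Σ[< n ] (f i))          ≡⟨ Σ²≡sum² m n f ⟩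
  Sum.sum (λ i → Sum.sum (f i))         ≡⟨ Sum.∑-comm f ⟩
  Sum.sum (λ j → Sum.sum (λ i → f i j)) ≡⟨ Σ²≡sum² n m (flip f) ⟨
  Σ[< n ] (λ j → Σ[< m ] (λ i → f i j))  ∎
  where
  open ≡-Reasoning
  Σ²≡sum² : ∀ m n (g : Fin m → Fin n → ℕ) →
    Σ[< m ] (λ i → Σ[< n ] (g i)) ≡ Sum.sum (λ i → Sum.sum (g i))
  Σ²≡sum² m n g = trans (Σ-cong m (λ i → Σ≡sum n (g i))) (Σ≡sum m _)

Π-comm : ∀ m n (f : Fin m → Fin n → ℕ) →
  Π[< m ] (λ i → Π[< n ] (f i)) ≡ Π[< n ] (λ j → Π[< m ] (λ i → f i j))
Π-comm m n f = begin
  Π[< m ] (λ i → Π[< n ] (f i))            ≡⟨ Π²≡product² m n f ⟩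
  Prod.sum (λ i → Prod.sum (f i))         ≡⟨ Prod.∑-comm f ⟩
  Prod.sum (λ j → Prod.sum (λ i → f i j)) ≡⟨ Π²≡product² n m (flip f) ⟨
  Π[< n ] (λ j → Π[< m ] (λ i → f i j))    ∎
  where
  open ≡-Reasoning
  Π²≡product² : ∀ m n (g : Fin m → Fin n → ℕ) →
    Π[< m ] (λ i → Π[< n ] (g i)) ≡ Prod.sum (λ i → Prod.sum (g i))
  Π²≡product² m n g = trans (Π-cong m (λ i → Π≡product n (g i))) (Π≡product m _)

Π-* : ∀ n (f g : Fin n → ℕ) → Π[< n ] (λ i → f i * g i) ≡ Π[< n ] f * Π[< n ] g
Π-* n f g = begin
  Π[< n ] (λ i → f i * g i)  ≡⟨ Π≡product n _ ⟩
  Prod.sum (λ i → f i * g i) ≡⟨ Prod.∑-distrib-+ f g ⟩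
  Prod.sum f * Prod.sum g    ≡⟨ cong₂ _*_ (Π≡product n f) (Π≡product n g) ⟨
  Π[< n ] f * Π[< n ] g      ∎
  where open ≡-Reasoning

Σ-*ˡ : ∀ n c (f : Fin n → ℕ) → Σ[< n ] (λ i → c * f i) ≡ c * Σ[< n ] f
Σ-*ˡ n c f = begin
  Σ[< n ] (λ i → c * f i) ≡⟨ Σ≡sum n _ ⟩
  Sum.sum (λ i → c * f i) ≡⟨ Sum.*-distribˡ-sum c f ⟨
  c * Sum.sum f           ≡⟨ cong (c *_) (Σ≡sum n f) ⟨
  c * Σ[< n ] f           ∎
  where open ≡-Reasoning

Σ-*ʳ : ∀ n c (f : Fin n → ℕ) → Σ[< n ] (λ i → f i * c) ≡ Σ[< n ] f * c
Σ-*ʳ n c f = begin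
  Σ[< n ] (λ i → f i * c) ≡⟨ Σ≡sum n _ ⟩
  Sum.sum (λ i → f i * c) ≡⟨ Sum.*-distribʳ-sum c f ⟨
  Sum.sum f * c           ≡⟨ cong (_* c) (Σ≡sum n f) ⟨
  Σ[< n ] f * c           ∎
  where open ≡-Reasoning

count : ∀ n → (Fin n → Bool) → ℕ
count n b = Σ[< n ] (λ i → if b i then 1 else 0)

Π-if≡^count : ∀ n (b : Fin n → Bool) c → Π[< n ] (λ i → if b i then c else 1) ≡ c ^ count n b
Π-if≡^count zero    b c = refl
Π-if≡^count (suc n) b c with b zero
... | true  = cong (c *_) (Π-if≡^count n (b ∘ suc) c)
... | false = trans (+-identityʳ _) (Π-if≡^count n (b ∘ suc) c)

T⇒0<count : ∀ n (b : Fin n → Bool) i → T (b i) → 0 < count n b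
T⇒0<count (suc n) b zero    t with b zero
... | true = s≤s z≤n
T⇒0<count (suc n) b (suc i) t = ≤-trans (T⇒0<count n (b ∘ suc) i t) (m≤n+m _ _)

length-concat-tabulate : ∀ {A : Set} n (f : Fin n → List A) → length (concat (tabulate f)) ≡ Σ[< n ] (length ∘ f)
length-concat-tabulate zero    f = refl
length-concat-tabulate (suc n) f =
  trans (length-++ (f zero)) (cong (length (f zero) +_) (length-concat-tabulate n (f ∘ suc)))

sum-concat-tabulate : ∀ n (f : Fin n → List ℕ) → sum (concat (tabulate f)) ≡ Σ[< n ] (sum ∘ f)
sum-concat-tabulate zero    f = refl
sum-concat-tabulate (suc n) f =
  trans (sum-++ (f zero) _) (cong (sum (f zero) +_) (sum-concat-tabulate n (f ∘ suc)))

product-concat-tabulate : ∀ n (f : Fin n → List ℕ) → product (concat (tabulate f)) ≡ Π[< n ] (product ∘ f)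
product-concat-tabulate zero    f = refl
product-concat-tabulate (suc n) f =
  trans (product-++ (f zero) _) (cong (product (f zero) *_) (product-concat-tabulate n (f ∘ suc)))

length-if-[] : ∀ {A : Set} b (x : A) → length (if b then [ x ] else []) ≡ (if b then 1 else 0)
length-if-[] true  x = refl
length-if-[] false x = refl

sum-if-[] : ∀ b x → sum (if b then [ x ] else []) ≡ (if b then x else 0)
sum-if-[] true  x = +-identityʳ x
sum-if-[] false x = refl

product-if-[*] : ∀ b x y → product (if b then [ x * y ] else []) ≡ (if b then x else 1) * (if b then y else 1)
product-if-[*] true  x y = *-identityʳ (x * y)
product-if-[*] false x y = refl

All-if-[] : ∀ {A : Set} {P : A → Set} b {x} → (T b → P x) → All P (if b then [ x ] else [])
All-if-[] true  Px = Px _ ∷ []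
All-if-[] false Px = []

if-0≤ : ∀ b x → (if b then x else 0) ≤ x
if-0≤ true  x = ≤-refl
if-0≤ false x = z≤n

¬T⇒if-0< : ∀ b {x} → ¬ T b → 0 < x → (if b then x else 0) < x
¬T⇒if-0< true  ¬t _   = ⊥-elim (¬t _)
¬T⇒if-0< false _  0<x = 0<x

T⇔T⇒≡ : ∀ {a b} → (T a → T b) → (T b → T a) → a ≡ b
T⇔T⇒≡ {true}  {true}  _ _ = refl
T⇔T⇒≡ {true}  {false} f _ = ⊥-elim (f _)
T⇔T⇒≡ {false} {true}  _ g = ⊥-elim (g _)
T⇔T⇒≡ {false} {false} _ _ = refl

module _ {p q : ℕ} (G : BipGraph p q) where

  private
    d = degU G
    e = degV G
    m = edges G

  edgeWeights : List ℕ
  edgeWeights = concat (tabulate λ u → concat (tabulate λ v → if adj G u v then [ d u * e v ] else []))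

  length-edgeWeights : length edgeWeights ≡ m
  length-edgeWeights = trans (length-concat-tabulate p _) (Σ-cong p λ u →
    trans (length-concat-tabulate q _) (Σ-cong q λ v → length-if-[] (adj G u v) _))

  sum-edgeWeights : sum edgeWeights ≡ Σ[< p ] (λ u → Σ[< q ] (λ v → if adj G u v then d u * e v else 0))
  sum-edgeWeights = trans (sum-concat-tabulate p _) (Σ-cong p λ u →
    trans (sum-concat-tabulate q _) (Σ-cong q λ v → sum-if-[] (adj G u v) _))

  product-edgeWeights : product edgeWeights ≡ expH G
  product-edgeWeights = begin
    product edgeWeights
      ≡⟨ product-concat-tabulate p _ ⟩
    Π[< p ] (λ u → product (concat (tabulate λ v → if adj G u v then [ d u * e v ] else [])))
      ≡⟨ Π-cong p (λ u → trans (product-concat-tabulate q _) (Π-cong q λ v → product-if-[*] (adj G u v) _ _)) ⟩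
    Π[< p ] (λ u → Π[< q ] (λ v → (if adj G u v then d u else 1) * (if adj G u v then e v else 1)))
      ≡⟨ Π-cong p (λ u → Π-* q _ _) ⟩
    Π[< p ] (λ u → Π[< q ] (λ v → if adj G u v then d u else 1) * Π[< q ] (λ v → if adj G u v then e v else 1))
      ≡⟨ Π-* p _ _ ⟩
    Π[< p ] (λ u → Π[< q ] (λ v → if adj G u v then d u else 1)) *
      Π[< p ] (λ u → Π[< q ] (λ v → if adj G u v then e v else 1))
      ≡⟨ cong (Π[< p ] (λ u → Π[< q ] (λ v → if adj G u v then d u else 1)) *_) (Π-comm p q _) ⟩
    Π[< p ] (λ u → Π[< q ] (λ v → if adj G u v then d u else 1)) *
      Π[< q ] (λ v → Π[< p ] (λ u → if adj G u v then e v else 1))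
      ≡⟨ cong₂ _*_ (Π-cong p λ u → Π-if≡^count q (adj G u) (d u))
                   (Π-cong q λ v → Π-if≡^count p (λ u → adj G u v) (e v)) ⟩
    expH G ∎
    where open ≡-Reasoning

  edges≡Σ-degV : m ≡ Σ[< q ] e
  edges≡Σ-degV = Σ-comm p q (λ u v → if adj G u v then 1 else 0)

  Σ-degU*degV : Σ[< p ] (λ u → Σ[< q ] (λ v → d u * e v)) ≡ m * m
  Σ-degU*degV = begin
    Σ[< p ] (λ u → Σ[< q ] (λ v → d u * e v)) ≡⟨ Σ-cong p (λ u → Σ-*ˡ q (d u) e) ⟩
    Σ[< p ] (λ u → d u * Σ[< q ] e)            ≡⟨ Σ-cong p (λ u → cong (d u *_) edges≡Σ-degV) ⟨
    Σ[< p ] (λ u → d u * m)                    ≡⟨ Σ-*ʳ p m d ⟩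
    m * m                                      ∎
    where open ≡-Reasoning

  weight≤degU*degV : ∀ u v → (if adj G u v then d u * e v else 0) ≤ d u * e v
  weight≤degU*degV u v = if-0≤ (adj G u v) _

  sum-edgeWeights≤ : sum edgeWeights ≤ m * m
  sum-edgeWeights≤ = begin
    sum edgeWeights                                                    ≡⟨ sum-edgeWeights ⟩
    Σ[< p ] (λ u → Σ[< q ] (λ v → if adj G u v then d u * e v else 0)) ≤⟨ Σ-mono p (λ u → Σ-mono q (weight≤degU*degV u)) ⟩
    Σ[< p ] (λ u → Σ[< q ] (λ v → d u * e v))                          ≡⟨ Σ-degU*degV ⟩
    m * m                                                              ∎
    where open ≤-Reasoning

  sum-edgeWeights< : ∀ {u v} → 0 < d u → 0 < e v → ¬ T (adj G u v) → sum edgeWeights < m * m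
  sum-edgeWeights< {u} {v} 0<du 0<ev ¬uv = begin-strict
    sum edgeWeights                                                    ≡⟨ sum-edgeWeights ⟩
    Σ[< p ] (λ u → Σ[< q ] (λ v → if adj G u v then d u * e v else 0)) <⟨ Σ-mono-< p (λ u → Σ-mono q (weight≤degU*degV u)) u
                                                                         (Σ-mono-< q (weight≤degU*degV u) v weight<) ⟩
    Σ[< p ] (λ u → Σ[< q ] (λ v → d u * e v))                          ≡⟨ Σ-degU*degV ⟩
    m * m                                                              ∎
    where
    open ≤-Reasoning
    weight< : (if adj G u v then d u * e v else 0) < d u * e v
    weight< = ¬T⇒if-0< (adj G u v) ¬uv (*-mono-≤ 0<du 0<ev)

  expH≤edges^edges : expH G ≤ m ^ m
  expH≤edges^edges = subst (_≤ m ^ m) product-edgeWeights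
    (sum≤*⇒product≤^ m edgeWeights length-edgeWeights sum-edgeWeights≤)

  expH<edges^edges : ∀ {u v} → 0 < m → 0 < d u → 0 < e v → ¬ T (adj G u v) → expH G < m ^ m
  expH<edges^edges 0<m 0<du 0<ev ¬uv = subst (_< m ^ m) product-edgeWeights
    (sum<*⇒product<^ m edgeWeights 0<m length-edgeWeights (sum-edgeWeights< 0<du 0<ev ¬uv))

  adj⇒0<degU : ∀ {u v} → T (adj G u v) → 0 < d u
  adj⇒0<degU {u} {v} = T⇒0<count q (adj G u) v

  adj⇒0<degV : ∀ {u v} → T (adj G u v) → 0 < e v
  adj⇒0<degV {u} {v} = T⇒0<count p (λ u → adj G u v) u

  module _ (complete : CompleteBipartiteModIsolated G) where

    degU-constant : ∀ {u u′} → 0 < d u → 0 < d u′ → d u ≡ d u′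
    degU-constant {u} {u′} 0<du 0<du′ = Σ-cong q λ v → cong (λ b → if b then 1 else 0)
      (T⇔T⇒≡ (complete u′ v 0<du′ ∘ adj⇒0<degV) (complete u v 0<du ∘ adj⇒0<degV))

    edges≡degV*degU : ∀ {u v} → T (adj G u v) → m ≡ e v * d u
    edges≡degV*degU {u} {v} uv = trans (Σ-cong p degU-via-v) (Σ-*ʳ p (d u) λ u′ → if adj G u′ v then 1 else 0)
      where
      degU-via-v : ∀ u′ → d u′ ≡ (if adj G u′ v then 1 else 0) * d u
      degU-via-v u′ with adj G u′ v in u′v
      ... | true  = trans (degU-constant (adj⇒0<degU (subst T (sym u′v) _)) (adj⇒0<degU uv)) (sym (*-identityˡ (d u)))
      ... | false = n≤0⇒n≡0 (≮⇒≥ λ 0<du′ → subst T u′v (complete u′ v 0<du′ (adj⇒0<degV uv)))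

    expH≡edges^edges : expH G ≡ m ^ m
    expH≡edges^edges = begin
      expH G                 ≡⟨ product-edgeWeights ⟨
      product edgeWeights    ≡⟨ All≡⇒product≡^ all≡m ⟩
      m ^ length edgeWeights ≡⟨ cong (m ^_) length-edgeWeights ⟩
      m ^ m                  ∎
      where
      open ≡-Reasoning
      all≡m : All (_≡ m) edgeWeights
      all≡m = concat⁺ (tabulate⁺ λ u → concat⁺ (tabulate⁺ λ v → All-if-[] (adj G u v) λ uv →
        trans (*-comm (d u) (e v)) (sym (edges≡degV*degU uv))))

theorem1 : ∀ (p q : ℕ) (G : BipGraph p q) → edges G ≥ 1 →
    (expH G ≤ edges G ^ edges G)
      × (expH G ≡ edges G ^ edges G ⇔ CompleteBipartiteModIsolated G)
theorem1 p q G 0<m = expH≤edges^edges G , mk⇔ equal⇒complete (expH≡edges^edges G)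
  where
  equal⇒complete : expH G ≡ edges G ^ edges G → CompleteBipartiteModIsolated G
  equal⇒complete expH≡m^m u v 0<du 0<ev = decidable-stable (T? (adj G u v)) λ ¬uv →
    <-irrefl expH≡m^m (expH<edges^edges G 0<m 0<du 0<ev ¬uv)
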